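{- Let $\mathcal{X}$ be an $n$-premaniplex and let $(\mathcal{Y},\eta)$ be an $(n,m)$-voltage operator (so in particular $(\mathcal{Y},\eta)$ is a voltage premaniplex). Then $\mathcal{X}\rtimes_\eta\mathcal{Y}$ is an $m$-premaniplex.
   Context: Graphs may have semiedges (a dart equal to its own inverse) and parallel edges. An $n$-premaniplex is a graph whose darts are colored by $\{0,\dots,n-1\}$ (a dart and its inverse have the same color) such that every vertex is the starting point of exactly one dart of each color, and for $|i-j|\ge 2$ every path of length 4 alternating colors $i,j$ is closed. For a vertex $x$, ${}^i x$ denotes the dart of color $i$ starting at $x$, and $x^i$ its endpoint. The group $\mathrm{Mon}(\mathcal U^n)=\langle r_0,\dots,r_{n-1}\mid r_i^2=1,\ (r_ir_j)^2=1 \text{ for } |i-j|\ge2\rangle$ acts on the left on the vertex set of every $n$-premaniplex by $r_i x=x^i$. A voltage assignment on a graph $\mathcal Y$ with group $G$ assigns $\eta(d)\in G$ to each dart $d$ with $\eta(d^{ -1})=\eta(d)^{ -1}$; the voltage of a path $d_1d_2\cdots d_k$ (traversed in this order) is $\eta(d_k)\cdots\eta(d_1)$. A voltage premaniplex is a premaniplex $\mathcal Y$ with a voltage assignment $\eta$ such that every path of length 4 alternating between two colors $i,j$ with $|i-j|\ge 2$ has trivial voltage. An $(n,m)$-voltage operator is a voltage premaniplex $(\mathcal Y,\eta)$ where $\mathcal Y$ is an $m$-premaniplex and the voltage group is $\mathrm{Mon}(\mathcal U^n)$. For an $n$-premaniplex $\mathcal X$, $\mathcal X\rtimes_\eta\mathcal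 Y$ is the $m$-edge-colored graph with vertex set $V(\mathcal X)\times V(\mathcal Y)$ in which, for each color $i\in\{0,\dots,m-1\}$, there is an edge of color $i$ joining $(x,y)$ and $(\eta({}^i y)\,x,\ y^i)$. -}

module Defs where

open import Data.Nat using (ℕ; _≤_; ∣_-_∣)
open import Data.Fin using (Fin; toℕ)
open import Data.List using (List; []; _∷_; _++_; reverse)
open import Data.Product using (_×_; _,_)
open import Relation.Binary.PropositionalEquality using (_≡_)

Far : {n : ℕ} → Fin n → Fin n → Set
Far i j = 2 ≤ ∣ toℕ i - toℕ j ∣

-- An n-premaniplex is given by its vertex set V together
-- with, for each colour i, the map x ↦ x^i (endpoint of the unique dart
-- of colour i at x).  The dart of colour i at x is identified with the
-- pair (x , i); its inverse is (x^i , i); it is a semiedge iff x^i = x.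

record IsPremaniplex (n : ℕ) (V : Set) (r : Fin n → V → V) : Set where
  field
    involutive  : ∀ i x → r i (r i x) ≡ x
    alt-closed  : ∀ i j → Far i j → ∀ x → r j (r i (r j (r i x))) ≡ x

record Premaniplex (n : ℕ) : Set₁ where
  field
    V  : Set
    r  : Fin n → V → V
    isPremaniplex : IsPremaniplex n V r
  open IsPremaniplex isPremaniplex public

-- Mon(U^n) = < r_0 … r_{n-1} | r_i^2 , (r_i r_j)^2 for |i-j| ≥ 2 >,
-- presented as words in the generators modulo the congruence generated
-- by the defining relations.  The word i₁ ∷ … ∷ iₖ denotes r_{i₁}⋯r_{iₖ}.

Word : ℕ → Set
Word n = List (Fin n)

infix 4 _≈_
data _≈_ {n : ℕ} : Word n → Word n → Set where
  ≈-refl  : ∀ {u} → u ≈ u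
  ≈-sym   : ∀ {u v} → u ≈ v → v ≈ u
  ≈-trans : ∀ {u v w} → u ≈ v → v ≈ w → u ≈ w
  ≈-cong  : ∀ {u u' v v'} → u ≈ u' → v ≈ v' → u ++ v ≈ u' ++ v'
  ≈-sq    : ∀ i → i ∷ i ∷ [] ≈ []
  ≈-comm  : ∀ i j → Far i j → i ∷ j ∷ i ∷ j ∷ [] ≈ []

_·_ : {n : ℕ} → Word n → Word n → Word n
u · v = u ++ v

ε : {n : ℕ} → Word n
ε = []

_⁻¹ : {n : ℕ} → Word n → Word n
u ⁻¹ = reverse u

act : {n : ℕ} (X : Premaniplex n) → Word n → Premaniplex.V X → Premaniplex.V X
act X []      x = x
act X (i ∷ w) x = Premaniplex.r X i (act X w x)

-- (n,m)-voltage operators.  η y i is the voltage of the dart of colour i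
-- starting at y.  The voltage of a path d₁d₂⋯dₖ is η(dₖ)⋯η(d₁).

record VoltageOperator (n m : ℕ) : Set₁ where
  field
    Y   : Premaniplex m
  open Premaniplex Y public
  field
    η   : V → Fin m → Word n
    -- η(d⁻¹) = η(d)⁻¹ ; the inverse of the dart (y,i) is (y^i,i)
    η-inv : ∀ i y → η (r i y) i ≈ (η y i) ⁻¹
    -- every alternating i,j path of length 4 (|i-j| ≥ 2) has trivial voltage:
    -- path  (y,i) (y^i,j) (y^{ij},i) (y^{iji},j)
    η-alt : ∀ i j → Far i j → ∀ y →
      η (r i (r j (r i y))) j · (η (r j (r i y)) i · (η (r i y) j · η y i)) ≈ ε

⋊V : {n m : ℕ} → Premaniplex n → VoltageOperator n m → Set
⋊V X O = Premaniplex.V X × VoltageOperator.V O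

⋊r : {n m : ℕ} (X : Premaniplex n) (O : VoltageOperator n m) →
     Fin m → ⋊V X O → ⋊V X O
⋊r X O i (x , y) = act X (VoltageOperator.η O y i) x , VoltageOperator.r O i y

{-# OPTIONS --safe #-}
-- Traversing a path of X ⋊_η Y moves the Y-coordinate along the underlying
-- path of Y and the X-coordinate by the voltage of that path.  Since the
-- defining relations of Mon(Uⁿ) hold in every n-premaniplex, this action
-- only depends on the voltage as a group element.  The two axioms of an
-- m-premaniplex then follow from those of Y together with the voltage
-- conditions η(d⁻¹) = η(d)⁻¹ and "alternating 4-paths have trivial voltage".
module Submission where

open import Defs
open import Data.Nat using (ℕ; _≤_)
open import Data.Nat.Properties using (∣-∣-comm)
open import Data.Fin using (Fin; toℕ)
open import Data.List using ([]; _∷_)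
open import Data.List.Properties using (unfold-reverse)
open import Data.Product using (_,_)
open import Function using (_∘′_)
open import Relation.Binary.PropositionalEquality
open ≡-Reasoning

Far-sym : {n : ℕ} (i j : Fin n) → Far i j → Far j i
Far-sym i j = subst (2 ≤_) (∣-∣-comm (toℕ i) (toℕ j))

module _ {n : ℕ} (X : Premaniplex n) where
  open Premaniplex X

  act-· : ∀ u v x → act X (u · v) x ≡ act X u (act X v x)
  act-· []      v x = refl
  act-· (i ∷ u) v x = cong (r i) (act-· u v x)

  act-resp-≈ : ∀ {u v} → u ≈ v → ∀ x → act X u x ≡ act X v x
  act-resp-≈ ≈-refl        x = refl
  act-resp-≈ (≈-sym p)     x = sym (act-resp-≈ p x)
  act-resp-≈ (≈-trans p q) x = trans (act-resp-≈ p x) (act-resp-≈ q x)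
  act-resp-≈ (≈-cong {u} {u'} {v} {v'} p q) x = begin
    act X (u · v) x          ≡⟨ act-· u v x ⟩
    act X u  (act X v x)     ≡⟨ act-resp-≈ p _ ⟩
    act X u' (act X v x)     ≡⟨ cong (act X u') (act-resp-≈ q x) ⟩
    act X u' (act X v' x)    ≡⟨ act-· u' v' x ⟨
    act X (u' · v') x        ∎
  act-resp-≈ (≈-sq i)       x = involutive i x
  act-resp-≈ (≈-comm i j f) x = alt-closed j i (Far-sym i j f) x

  act-inverseˡ : ∀ w x → act X (w ⁻¹) (act X w x) ≡ x
  act-inverseˡ []      x = refl
  act-inverseˡ (i ∷ w) x = begin
    act X ((i ∷ w) ⁻¹) (r i (act X w x))          ≡⟨ cong (λ u → act X u (r i (act X w x))) (unfold-reverse i w) ⟩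
    act X ((w ⁻¹) · (i ∷ [])) (r i (act X w x))   ≡⟨ act-· (w ⁻¹) (i ∷ []) _ ⟩
    act X (w ⁻¹) (r i (r i (act X w x)))         ≡⟨ cong (act X (w ⁻¹)) (involutive i _) ⟩
    act X (w ⁻¹) (act X w x)                     ≡⟨ act-inverseˡ w x ⟩
    x                                            ∎

module _ {n m : ℕ} (X : Premaniplex n) (O : VoltageOperator n m) where
  open VoltageOperator O

  ⋊-involutive : ∀ i p → ⋊r X O i (⋊r X O i p) ≡ p
  ⋊-involutive i (x , y) = cong₂ _,_ first (involutive i y)
    where
    first : act X (η (r i y) i) (act X (η y i) x) ≡ x
    first = begin
      act X (η (r i y) i) (act X (η y i) x)    ≡⟨ act-resp-≈ X (η-inv i y) _ ⟩
      act X (η y i ⁻¹) (act X (η y i) x)       ≡⟨ act-inverseˡ X (η y i) x ⟩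
      x                                        ∎

  ⋊-alt-closed : ∀ i j → Far i j → ∀ p →
    ⋊r X O j (⋊r X O i (⋊r X O j (⋊r X O i p))) ≡ p
  ⋊-alt-closed i j f (x , y) = cong₂ _,_ first (alt-closed i j f y)
    where
    a = η y i
    b = η (r i y) j
    c = η (r j (r i y)) i
    d = η (r i (r j (r i y))) j
    first : act X d (act X c (act X b (act X a x))) ≡ x
    first = begin
      act X d (act X c (act X b (act X a x)))   ≡⟨ cong (act X d ∘′ act X c) (act-· X b a x) ⟨
      act X d (act X c (act X (b · a) x))       ≡⟨ cong (act X d) (act-· X c (b · a) x) ⟨
      act X d (act X (c · (b · a)) x)           ≡⟨ act-· X d (c · (b · a)) x ⟨
      act X (d · (c · (b · a))) x               ≡⟨ act-resp-≈ X (η-alt i j f y) x ⟩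
      x                                         ∎

proposition3p3 : {n m : ℕ} (X : Premaniplex n) (O : VoltageOperator n m) →
    IsPremaniplex m (⋊V X O) (⋊r X O)
proposition3p3 X O = record
  { involutive = ⋊-involutive X O
  ; alt-closed = ⋊-alt-closed X O
  }
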